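{- Let $t_{5_1}$ be the ternary tree whose root has three children, the left child of the root has three children, and all other vertices are leaves; let $t_{5_2}$ be the analogous tree in which the center child of the root (instead of the left child) has three children. Then $$g_{t_{5_1}}(x)=g_{t_{5_2}}(x)=\frac{1-\sqrt{1-4x^2}}{2x}.$$ Equivalently, $\mathrm{av}_{t}(0)=0$, $\mathrm{av}_t(1)=1$, $\mathrm{av}_t(2)=0$ and $\mathrm{av}_t(n)=\sum_{k=1}^{n-2}\mathrm{av}_t(k)\,\mathrm{av}_t(n-k-1)$ for $n\ge 3$, for $t\in\{t_{5_1},t_{5_2}\}$.
   Context: A ternary tree is a rooted ordered tree in which every vertex has either $0$ children (a leaf) or exactly $3$ ordered children (left, center, right). A ternary tree $T$ contains a ternary tree pattern $t$ if there is a vertex $v$ of $T$ such that, placing the root of $t$ at $v$ and matching children in order, every internal vertex of $t$ corresponds to an internal vertex of $T$ (i.e. $t$ is a contiguous, rooted, ordered subtree of $T$); otherwise $T$ avoids $t$. $\mathrm{av}_t(n)$ is the number of ternary trees with $n$ leaves that avoid $t$ (so $\mathrm{av}_t(n)=0$ for even $n$, and the single-vertex tree counts as the unique tree with $1$ leaf), and $g_t(x)=\sum_{n\ge 0}\mathrm{av}_t(n)x^n$. -}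

module Defs where

open import Data.Nat using (ℕ; zero; suc; _+_)
open import Data.Bool using (Bool; true; false; _∧_; _∨_)
open import Data.Product using (Σ; _×_)
open import Relation.Binary.PropositionalEquality using (_≡_)

data Tree : Set where
  leaf : Tree
  node : Tree → Tree → Tree → Tree   -- left, center, right

leaves : Tree → ℕ
leaves leaf = 1
leaves (node l c r) = leaves l + leaves c + leaves r

-- matchesAt t T : placing the root of t at the root of T, every internal
-- vertex of t corresponds to an internal vertex of T (children matched in order).
matchesAt : Tree → Tree → Bool
matchesAt leaf _ = true
matchesAt (node a b c) leaf = false
matchesAt (node a b c) (node x y z) = matchesAt a x ∧ matchesAt b y ∧ matchesAt c z

contains : Tree → Tree → Bool
contains t leaf = matchesAt t leaf
contains t (node x y z) =
  matchesAt t (node x y z) ∨ contains t x ∨ contains t y ∨ contains t z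

Avoids : Tree → Tree → Set
Avoids t T = contains t T ≡ false

-- the set of ternary trees with n leaves avoiding t (av_t(n) is its cardinality)
AvoidingTrees : Tree → ℕ → Set
AvoidingTrees t n = Σ Tree (λ T → (leaves T ≡ n) × Avoids t T)

t51 : Tree
t51 = node (node leaf leaf leaf) leaf leaf

t52 : Tree
t52 = node leaf (node leaf leaf leaf) leaf

module Submission where

open import Defs
open import Data.Nat using (ℕ; _+_; _*_; _∸_; _≤_)
open import Data.List using (map; upTo; drop)
open import Data.Nat.ListAction using (sum)
open import Data.Fin using (Fin)
open import Data.Product using (Σ; _×_)
open import Data.Sum using (_⊎_)
open import Relation.Binary.PropositionalEquality using (_≡_)
open import Function.Bundles using (_↔_)

open import Algebra.Bundles using (CommutativeMonoid)
open import Axiom.UniquenessOfIdentityProofs using (module Decidable⇒UIP)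
open import Data.Bool using (false; _∧_; _∨_)
import Data.Bool.Properties as Bool
open import Data.Empty using (⊥-elim)
open import Data.Fin using (zero)
open import Data.Fin.Properties using (+↔⊎; *↔×)
open import Data.List using (_++_; [_]; _∷_; applyUpTo)
open import Data.List.Properties using (applyUpTo-∷ʳ; map-applyUpTo)
open import Data.Nat using (zero; suc; _<_; s≤s; z≤n)
open import Data.Nat.Induction using (<-rec)
open import Data.Nat.ListAction.Properties using (sum-++)
open import Data.Nat.Properties as ℕ
  using (m≤m+n; m≤n+m; n<1+n; +-comm; +-identityʳ; n∸n≡0; *-zeroʳ; ∸-+-assoc;
         suc-injective; m+n≡0⇒m≡0)
open import Data.Product using (_,_; proj₁)
open import Data.Product.Function.Dependent.Propositional using (Σ-↔)
open import Data.Product.Function.NonDependent.Propositional using (_×-↔_)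
open import Data.Sum using (inj₁; inj₂)
open import Data.Sum.Function.Propositional using (_⊎-↔_)
open import Function.Base using (_∘_)
open import Function.Bundles using (mk↔ₛ′)
open import Function.Properties.Inverse using (↔-refl; ↔-trans)
open import Relation.Binary.PropositionalEquality using (refl; sym; trans; cong; cong₂)
open import Relation.Nullary using (¬_)

open import Algebra.Properties.CommutativeSemigroup
  (CommutativeMonoid.commutativeSemigroup Bool.∧-commutativeMonoid)
  using () renaming (x∙yz≈y∙xz to ∧-swapˡ)
open import Algebra.Properties.CommutativeSemigroup
  (CommutativeMonoid.commutativeSemigroup Bool.∨-commutativeMonoid)
  using () renaming (x∙yz≈y∙xz to ∨-swapˡ)

open import Relation.Binary.PropositionalEquality using (module ≡-Reasoning)
import Function.Related.Propositional as Related
open Decidable⇒UIP Bool._≟_ using () renaming (≡-irrelevant to Bool-≡-irrelevant)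

-- A tree avoids t₅₁ iff it is a leaf or its root has a leaf as left child and
-- t₅₁-avoiding center and right subtrees. So an avoider with m + 1 leaves is
-- either the single leaf (m = 0) or an ordered pair of avoiders with a + b = m
-- leaves, and any family of sets decomposing this way is counted by the
-- convolution recurrence av(m + 1) = [m = 0] + Σ_{a+b=m} av(a) av(b).
-- Exchanging the first two children at every vertex maps t₅₁ to t₅₂ and
-- preserves leaf numbers and containment, so t₅₂ has the same counts.

δ₀ : ℕ → ℕ
δ₀ zero    = 1
δ₀ (suc _) = 0

Split : (ℕ → ℕ → Set) → ℕ → Set
Split P m = Σ ℕ λ a → Σ ℕ λ b → (a + b ≡ m) × P a b

convolution : (ℕ → ℕ → ℕ) → ℕ → ℕ
convolution h zero    = h 0 0
convolution h (suc m) = h 0 (suc m) + convolution (λ a b → h (suc a) b) m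

summands≤ : ∀ {a b m} → a + b ≡ m → a ≤ m × b ≤ m
summands≤ {a} {b} refl = m≤m+n a b , m≤n+m b a

Split-zero : ∀ {P : ℕ → ℕ → Set} → P 0 0 ↔ Split P 0
Split-zero {P} = mk↔ₛ′ (λ p → 0 , 0 , refl , p) from to∘from (λ _ → refl)
  where
  from : Split P 0 → P 0 0
  from (zero , zero , refl , p) = p
  to∘from : ∀ s → (0 , 0 , refl , from s) ≡ s
  to∘from (zero , zero , refl , p) = refl

Split-suc : ∀ {P : ℕ → ℕ → Set} {m} →
  (P 0 (suc m) ⊎ Split (λ a b → P (suc a) b) m) ↔ Split P (suc m)
Split-suc {P} {m} = mk↔ₛ′ to from to∘from from∘to
  where
  to : P 0 (suc m) ⊎ Split (λ a b → P (suc a) b) m → Split P (suc m)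
  to (inj₁ p)               = 0 , suc m , refl , p
  to (inj₂ (a , b , e , p)) = suc a , b , cong suc e , p
  from : Split P (suc m) → P 0 (suc m) ⊎ Split (λ a b → P (suc a) b) m
  from (zero  , b , refl , p) = inj₁ p
  from (suc a , b , refl , p) = inj₂ (a , b , refl , p)
  to∘from : ∀ s → to (from s) ≡ s
  to∘from (zero  , b , refl , p) = refl
  to∘from (suc a , b , refl , p) = refl
  from∘to : ∀ s → from (to s) ≡ s
  from∘to (inj₁ p)                  = refl
  from∘to (inj₂ (a , b , refl , p)) = refl

Split-cong : ∀ {P Q : ℕ → ℕ → Set} {m} →
  (∀ a b → a + b ≡ m → P a b ↔ Q a b) → Split P m ↔ Split Q m
Split-cong P↔Q = Σ-↔ ↔-refl λ {a} → Σ-↔ ↔-refl λ {b} → Σ-↔ ↔-refl λ {e} → P↔Q a b e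

Fin-convolution : ∀ h m → Fin (convolution h m) ↔ Split (λ a b → Fin (h a b)) m
Fin-convolution h zero    = Split-zero
Fin-convolution h (suc m) =
  ↔-trans +↔⊎ (↔-trans (↔-refl ⊎-↔ Fin-convolution (λ a b → h (suc a) b) m) Split-suc)

convolution-cong : ∀ h k m → (∀ a b → a + b ≡ m → h a b ≡ k a b) →
  convolution h m ≡ convolution k m
convolution-cong h k zero    h≡k = h≡k 0 0 refl
convolution-cong h k (suc m) h≡k = cong₂ _+_ (h≡k 0 (suc m) refl)
  (convolution-cong (λ a b → h (suc a) b) (λ a b → k (suc a) b) m
    (λ a b e → h≡k (suc a) b (cong suc e)))

convolution-sum : ∀ h m → convolution h m ≡ sum (applyUpTo (λ a → h a (m ∸ a)) (suc m))
convolution-sum h zero    = sym (+-identityʳ (h 0 0))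
convolution-sum h (suc m) = cong (h 0 (suc m) +_) (convolution-sum (λ a b → h (suc a) b) m)

convolution-square-cong : ∀ {u v : ℕ → ℕ} m → (∀ {a} → a ≤ m → u a ≡ v a) →
  convolution (λ a b → u a * u b) m ≡ convolution (λ a b → v a * v b) m
convolution-square-cong m u≡v = convolution-cong _ _ m λ a b e →
  let a≤m , b≤m = summands≤ e in cong₂ _*_ (u≡v a≤m) (u≡v b≤m)

sum-applyUpTo-suc : ∀ (g : ℕ → ℕ) n → sum (applyUpTo g (suc n)) ≡ sum (applyUpTo g n) + g n
sum-applyUpTo-suc g n = begin
  sum (applyUpTo g (suc n))                ≡⟨ cong sum (applyUpTo-∷ʳ g n) ⟨
  sum (applyUpTo g n ++ [ g n ])          ≡⟨ sum-++ (applyUpTo g n) [ g n ] ⟩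
  sum (applyUpTo g n) + (g n + 0)         ≡⟨ cong (sum (applyUpTo g n) +_) (+-identityʳ (g n)) ⟩
  sum (applyUpTo g n) + g n               ∎
  where open ≡-Reasoning

applyUpTo-cong : ∀ {f g : ℕ → ℕ} n → (∀ a → f a ≡ g a) → applyUpTo f n ≡ applyUpTo g n
applyUpTo-cong zero    f≡g = refl
applyUpTo-cong (suc n) f≡g = cong₂ _∷_ (f≡g 0) (applyUpTo-cong n (f≡g ∘ suc))

[1+m]∸n∸1≡m∸n : ∀ m n → suc m ∸ n ∸ 1 ≡ m ∸ n
[1+m]∸n∸1≡m∸n m n = trans (∸-+-assoc (suc m) n 1) (cong (suc m ∸_) (+-comm n 1))

-- catalan (2k + 1) is the k-th Catalan number and catalan vanishes on even
-- arguments; the fuel f of catalan-fuel f n is enough as soon as n < f.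
catalan-fuel : ℕ → ℕ → ℕ
catalan-fuel zero    _       = 0
catalan-fuel (suc f) zero    = 0
catalan-fuel (suc f) (suc m) =
  δ₀ m + convolution (λ a b → catalan-fuel f a * catalan-fuel f b) m

catalan : ℕ → ℕ
catalan n = catalan-fuel (suc n) n

catalan-fuel-stable : ∀ f g n → n < f → n < g → catalan-fuel f n ≡ catalan-fuel g n
catalan-fuel-stable (suc f) (suc g) zero    _         _         = refl
catalan-fuel-stable (suc f) (suc g) (suc m) (s≤s m<f) (s≤s m<g) =
  cong (δ₀ m +_) (convolution-square-cong m λ {a} a≤m →
    catalan-fuel-stable f g a (ℕ.<-≤-trans (s≤s a≤m) m<f) (ℕ.<-≤-trans (s≤s a≤m) m<g))

catalan-suc : ∀ m → catalan (suc m) ≡ δ₀ m + convolution (λ a b → catalan a * catalan b) m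
catalan-suc m = cong (δ₀ m +_) (convolution-square-cong m λ {a} a≤m →
  catalan-fuel-stable (suc m) (suc a) a (s≤s a≤m) (n<1+n a))

record BinaryDecomposition (X : ℕ → Set) : Set₁ where
  field
    empty : ¬ X 0
    split : ∀ m → X (suc m) ↔ (Fin (δ₀ m) ⊎ Split (λ a b → X a × X b) m)

catalan-counts : ∀ {X} → BinaryDecomposition X → ∀ n → Fin (catalan n) ↔ X n
catalan-counts {X} D = <-rec (λ n → Fin (catalan n) ↔ X n) counts
  where
  open BinaryDecomposition D
  open Related.EquationalReasoning
  counts : ∀ n → (∀ {a} → a < n → Fin (catalan a) ↔ X a) → Fin (catalan n) ↔ X n
  counts zero    _  = mk↔ₛ′ (λ ()) (⊥-elim ∘ empty) (⊥-elim ∘ empty) (λ ())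
  counts (suc m) ih = begin
    Fin (catalan (suc m))
      ↔⟨ Related.≡⇒ (cong Fin (catalan-suc m)) ⟩
    Fin (δ₀ m + convolution (λ a b → catalan a * catalan b) m)
      ↔⟨ +↔⊎ ⟩
    (Fin (δ₀ m) ⊎ Fin (convolution (λ a b → catalan a * catalan b) m))
      ↔⟨ ↔-refl ⊎-↔ Fin-convolution _ m ⟩
    (Fin (δ₀ m) ⊎ Split (λ a b → Fin (catalan a * catalan b)) m)
      ↔⟨ ↔-refl ⊎-↔ Split-cong (λ a b e → ↔-trans *↔× (ih′ (summands≤ e))) ⟩
    (Fin (δ₀ m) ⊎ Split (λ a b → X a × X b) m)
      ↔⟨ split m ⟨
    X (suc m) ∎
    where
    ih′ : ∀ {a b} → a ≤ m × b ≤ m → (Fin (catalan a) × Fin (catalan b)) ↔ (X a × X b)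
    ih′ (a≤m , b≤m) = ih (s≤s a≤m) ×-↔ ih (s≤s b≤m)

catalan-recurrence : (n : ℕ) → 3 ≤ n →
  catalan n ≡ sum (map (λ k → catalan k * catalan (n ∸ k ∸ 1)) (drop 1 (upTo (n ∸ 1))))
-- The a = 0 summand of the convolution is catalan 0 * _, which is 0 by
-- computation; only the last summand a = 2 + k needs an argument.
catalan-recurrence (suc (suc (suc k))) (s≤s (s≤s (s≤s z≤n))) = begin
  catalan (3 + k)
    ≡⟨ catalan-suc (2 + k) ⟩
  convolution (λ a b → catalan a * catalan b) (2 + k)
    ≡⟨ convolution-sum (λ a b → catalan a * catalan b) (2 + k) ⟩
  sum (applyUpTo g (2 + k))
    ≡⟨ sum-applyUpTo-suc g (suc k) ⟩
  sum (applyUpTo g (suc k)) + g (suc k)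
    ≡⟨ cong (sum (applyUpTo g (suc k)) +_) last-vanishes ⟩
  sum (applyUpTo g (suc k)) + 0
    ≡⟨ +-identityʳ (sum (applyUpTo g (suc k))) ⟩
  sum (applyUpTo g (suc k))
    ≡⟨ cong sum interior ⟨
  sum (map (λ j → catalan j * catalan (3 + k ∸ j ∸ 1)) (applyUpTo suc (suc k))) ∎
  where
  open ≡-Reasoning
  g : ℕ → ℕ
  g a = catalan (suc a) * catalan (suc k ∸ a)
  last-vanishes : g (suc k) ≡ 0
  last-vanishes =
    trans (cong (λ x → catalan (2 + k) * catalan x) (n∸n≡0 k)) (*-zeroʳ (catalan (2 + k)))
  interior : map (λ j → catalan j * catalan (3 + k ∸ j ∸ 1)) (applyUpTo suc (suc k))
           ≡ applyUpTo g (suc k)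
  interior = trans (map-applyUpTo suc _ (suc k)) (applyUpTo-cong (suc k) λ a →
    cong (λ x → catalan (suc a) * catalan x) ([1+m]∸n∸1≡m∸n (suc k) a))

leaves-nonzero : ∀ T → ¬ leaves T ≡ 0
leaves-nonzero (node l c r) e =
  leaves-nonzero l (m+n≡0⇒m≡0 (leaves l) (m+n≡0⇒m≡0 (leaves l + leaves c) e))

AvoidingTrees-≡ : ∀ {t n} {x y : AvoidingTrees t n} → proj₁ x ≡ proj₁ y → x ≡ y
AvoidingTrees-≡ {x = T , e , p} {y = .T , e′ , p′} refl =
  cong₂ (λ e p → T , e , p) (ℕ.≡-irrelevant e e′) (Bool-≡-irrelevant p p′)

t51-avoiders : BinaryDecomposition (AvoidingTrees t51)
t51-avoiders = record
  { empty = λ (T , e , _) → leaves-nonzero T e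
  ; split = λ _ → mk↔ₛ′ to from to∘from from∘to
  }
  where
  Pairs : ℕ → Set
  Pairs = Split (λ a b → AvoidingTrees t51 a × AvoidingTrees t51 b)

  to : ∀ {m} → AvoidingTrees t51 (suc m) → Fin (δ₀ m) ⊎ Pairs m
  to (leaf , refl , _) = inj₁ zero
  to (node leaf y z , e , p) =
    inj₂ (leaves y , leaves z , suc-injective e ,
          (y , refl , Bool.∨-conicalˡ _ _ p) , (z , refl , Bool.∨-conicalʳ _ _ p))
  to (node (node _ _ _) _ _ , _ , ())

  from : ∀ {m} → Fin (δ₀ m) ⊎ Pairs m → AvoidingTrees t51 (suc m)
  from (inj₂ (_ , _ , refl , (y , refl , py) , (z , refl , pz))) =
    node leaf y z , refl , cong₂ _∨_ py pz
  from {zero} (inj₁ zero) = leaf , refl , refl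

  to∘from : ∀ {m} (s : Fin (δ₀ m) ⊎ Pairs m) → to (from s) ≡ s
  to∘from (inj₂ (_ , _ , refl , (y , refl , py) , (z , refl , pz))) =
    cong₂ (λ p q → inj₂ (_ , _ , refl , (y , refl , p) , (z , refl , q)))
          (Bool-≡-irrelevant _ _) (Bool-≡-irrelevant _ _)
  to∘from {zero} (inj₁ zero) = refl

  from∘to : ∀ {m} (x : AvoidingTrees t51 (suc m)) → from (to x) ≡ x
  from∘to (leaf , refl , refl)             = refl
  from∘to (node leaf y z , refl , _)       = AvoidingTrees-≡ refl
  from∘to (node (node _ _ _) _ _ , _ , ())

-- swap t51 computes to t52.
swap : Tree → Tree
swap leaf         = leaf
swap (node l c r) = node (swap c) (swap l) (swap r)

swap-involutive : ∀ T → swap (swap T) ≡ T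
swap-involutive leaf         = refl
swap-involutive (node l c r)
  rewrite swap-involutive l | swap-involutive c | swap-involutive r = refl

swap-↔ : Tree ↔ Tree
swap-↔ = mk↔ₛ′ swap swap swap-involutive swap-involutive

leaves-swap : ∀ T → leaves (swap T) ≡ leaves T
leaves-swap leaf = refl
leaves-swap (node l c r) rewrite leaves-swap l | leaves-swap c | leaves-swap r =
  cong (_+ leaves r) (+-comm (leaves c) (leaves l))

matchesAt-swap : ∀ s T → matchesAt (swap s) (swap T) ≡ matchesAt s T
matchesAt-swap leaf         _            = refl
matchesAt-swap (node a b c) leaf         = refl
matchesAt-swap (node a b c) (node x y z) =
  trans (∧-swapˡ (matchesAt (swap b) (swap y)) (matchesAt (swap a) (swap x))
                 (matchesAt (swap c) (swap z)))
        (cong₂ _∧_ (matchesAt-swap a x) (cong₂ _∧_ (matchesAt-swap b y) (matchesAt-swap c z)))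

contains-swap : ∀ s T → contains (swap s) (swap T) ≡ contains s T
contains-swap s leaf         = matchesAt-swap s leaf
contains-swap s (node x y z) =
  cong₂ _∨_ (matchesAt-swap s (node x y z))
    (trans (∨-swapˡ (contains (swap s) (swap y)) (contains (swap s) (swap x))
                    (contains (swap s) (swap z)))
           (cong₂ _∨_ (contains-swap s x) (cong₂ _∨_ (contains-swap s y) (contains-swap s z))))

AvoidingTrees-swap : ∀ t n → AvoidingTrees t n ↔ AvoidingTrees (swap t) n
AvoidingTrees-swap t n = Σ-↔ swap-↔ λ {T} →
  Related.≡⇒ (cong₂ (λ k b → (k ≡ n) × (b ≡ false))
                    (sym (leaves-swap T)) (sym (contains-swap t T)))

mainTheorem2 : (t : Tree) → (t ≡ t51) ⊎ (t ≡ t52) →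
    Σ (ℕ → ℕ) λ av →
    ((n : ℕ) → Fin (av n) ↔ AvoidingTrees t n)
    × (av 0 ≡ 0) × (av 1 ≡ 1) × (av 2 ≡ 0)
    × ((n : ℕ) → 3 ≤ n →
    av n ≡ sum (map (λ k → av k * av (n ∸ k ∸ 1)) (drop 1 (upTo (n ∸ 1)))))
mainTheorem2 t (inj₁ refl) =
  catalan , catalan-counts t51-avoiders , refl , refl , refl , catalan-recurrence
mainTheorem2 t (inj₂ refl) =
  catalan , (λ n → ↔-trans (catalan-counts t51-avoiders n) (AvoidingTrees-swap t51 n)) ,
  refl , refl , refl , catalan-recurrence
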